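{- Let $n\geq1$, let $M_1(\vec x,\vec y,\vec z)$ and $M_2(\vec x,\vec y,\vec z)$ be $3n$-ary RE relations (with $\vec x,\vec y,\vec z\in\mathbb N^n$), and let $G:\mathbb N^2\to\mathbb N^n$ be a recursive $n$-ary functional on $\mathbb N^2$. Then there are $n$-ary recursive functions $f_1(\vec y)$ and $f_2(\vec y)$ such that for all $\vec y,\vec x\in\mathbb N^n$: (1) $\vec x\in R^n_{f_1(\vec y)}\Leftrightarrow M_1(\vec x,\vec y,G(f_1(\vec y),f_2(\vec y)))$; (2) $\vec x\in R^n_{f_2(\vec y)}\Leftrightarrow M_2(\vec x,\vec y,G(f_1(\vec y),f_2(\vec y)))$.
   Context: $\langle R^n_i:i\in\omega\rangle$ is an acceptable enumeration of all $n$-ary RE relations. An $n$-ary functional on $\mathbb N^k$ is a map $G=(g_1,\dots,g_n):\mathbb N^k\to\mathbb N^n$; it is recursive if each $g_i$ is recursive. -}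

module Defs where

open import Data.Nat using (ℕ; zero; suc; _<_)
open import Data.Fin using (Fin)
open import Data.Vec using (Vec; []; _∷_; lookup; head; tail; _++_)
open import Data.Product using (Σ; ∃; _×_)
open import Function.Bundles using (_⇔_)

data Code : ℕ → Set where
  zeroᶜ : ∀ {k} → Code k
  succᶜ : Code 1
  projᶜ : ∀ {k} → Fin k → Code k
  compᶜ : ∀ {k m} → Code m → Vec (Code k) m → Code k
  precᶜ : ∀ {k} → Code k → Code (suc (suc k)) → Code (suc k) -- primitive recursion (on first argument)
  muᶜ   : ∀ {k} → Code (suc k) → Code k                    -- unbounded minimisation (on first argument)

mutual
  data _⊢_⇓_ : ∀ {k} → Code k → Vec ℕ k → ℕ → Set where
    ev-zero : ∀ {k} {xs : Vec ℕ k} → zeroᶜ ⊢ xs ⇓ 0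
    ev-succ : ∀ {x} → succᶜ ⊢ (x ∷ []) ⇓ suc x
    ev-proj : ∀ {k} {i : Fin k} {xs} → projᶜ i ⊢ xs ⇓ lookup xs i
    ev-comp : ∀ {k m} {f : Code m} {gs : Vec (Code k) m} {xs ys v} →
              EvalAll gs xs ys → f ⊢ ys ⇓ v → compᶜ f gs ⊢ xs ⇓ v
    ev-prec0 : ∀ {k} {f : Code k} {g : Code (suc (suc k))} {xs v} →
               f ⊢ xs ⇓ v → precᶜ f g ⊢ (0 ∷ xs) ⇓ v
    ev-precS : ∀ {k} {f : Code k} {g : Code (suc (suc k))} {y xs r v} →
               precᶜ f g ⊢ (y ∷ xs) ⇓ r → g ⊢ (y ∷ r ∷ xs) ⇓ v →
               precᶜ f g ⊢ (suc y ∷ xs) ⇓ v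
    ev-mu : ∀ {k} {f : Code (suc k)} {xs y} →
            f ⊢ (y ∷ xs) ⇓ 0 →
            (∀ z → z < y → ∃ λ w → f ⊢ (z ∷ xs) ⇓ suc w) →
            muᶜ f ⊢ xs ⇓ y

  data EvalAll {k : ℕ} : ∀ {m} → Vec (Code k) m → Vec ℕ k → Vec ℕ m → Set where
    []  : ∀ {xs} → EvalAll [] xs []
    _∷_ : ∀ {m} {g : Code k} {gs : Vec (Code k) m} {xs y ys} →
          g ⊢ xs ⇓ y → EvalAll gs xs ys → EvalAll (g ∷ gs) xs (y ∷ ys)

Recursive : ∀ {k} → (Vec ℕ k → ℕ) → Set
Recursive {k} f = Σ (Code k) λ c → ∀ xs → c ⊢ xs ⇓ f xs

RecursiveFunctional : ∀ {k n} → (Vec ℕ k → Vec ℕ n) → Set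
RecursiveFunctional {k} {n} G = ∀ (i : Fin n) → Recursive (λ xs → lookup (G xs) i)

RE : ∀ {k} → (Vec ℕ k → Set) → Set
RE {k} M = Σ (Code k) λ c → ∀ xs → M xs ⇔ (∃ λ v → c ⊢ xs ⇓ v)

-- An enumeration ⟨R_i : i ∈ ω⟩ of n-ary relations is acceptable (Smullyan):
--  (i) the relation  R_i(x⃗)  of (i, x⃗) is RE, and
--  (ii) iteration property: for every m and every RE relation M(x⃗, y⃗)
--       (x⃗ ∈ ℕ^n, y⃗ ∈ ℕ^m) there is a recursive t(y⃗) with
--       x⃗ ∈ R_{t(y⃗)} ⇔ M(x⃗, y⃗).
Acceptable : ∀ n → (ℕ → Vec ℕ n → Set) → Set₁
Acceptable n R =
  RE (λ (w : Vec ℕ (suc n)) → R (head w) (tail w)) ×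
  (∀ m (M : Vec ℕ (n Data.Nat.+ m) → Set) → RE M →
     Σ (Vec ℕ m → ℕ) λ t → Recursive t ×
       (∀ (y : Vec ℕ m) (x : Vec ℕ n) → R (t y) x ⇔ M (x ++ y)))

-- The diagonal argument of the recursion theorem, done for r relations at once.
-- Iteration gives recursive Tᵢ with  x ∈ R (Tᵢ(y, z)) ⇔ (x, y, z) ∈ R (zᵢ),  and
-- every RE relation has an index, so let aᵢ be an index of
--   (x, y, z) ↦ Mᵢ(x, y, G(T₁(y, z), …, T_r(y, z))).
-- Then fᵢ(y) = Tᵢ(y, a) works: the parameter zᵢ = aᵢ is read back as the index
-- of exactly the relation Tᵢ was built from.
module Submission where

open import Defs
open import Data.Fin using (Fin; zero; suc; _↑ˡ_; _↑ʳ_)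
open import Data.Nat using (ℕ; zero; suc; _+_; _≥_)
open import Data.Nat.Properties using (<-cmp)
open import Data.Product using (Σ; _×_; _,_; proj₁; proj₂)
open import Data.Vec using (Vec; []; _∷_; _++_; lookup; tabulate; map)
open import Data.Vec.Properties
  using (lookup-++ˡ; lookup-++ʳ; lookup∘tabulate; tabulate∘lookup; tabulate-cong)
open import Function using (_∘_; id; const)
open import Function.Bundles using (_⇔_; mk⇔; Equivalence)
open import Function.Properties.Equivalence using (⇔-setoid)
open import Level using (0ℓ)
open import Relation.Binary.Definitions using (tri<; tri≈; tri>)
open import Relation.Binary.PropositionalEquality
  using (_≡_; refl; trans; cong; cong₂; subst)
open import Relation.Binary.Reasoning.Setoid (⇔-setoid 0ℓ)
open import Relation.Nullary using (contradiction)

private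
  variable
    j k m n : ℕ

mutual
  ⇓-deterministic : {c : Code k} {xs : Vec ℕ k} {v w : ℕ} →
                    c ⊢ xs ⇓ v → c ⊢ xs ⇓ w → v ≡ w
  ⇓-deterministic ev-zero ev-zero = refl
  ⇓-deterministic ev-succ ev-succ = refl
  ⇓-deterministic ev-proj ev-proj = refl
  ⇓-deterministic (ev-comp e d) (ev-comp e′ d′)
    with refl ← EvalAll-deterministic e e′ = ⇓-deterministic d d′
  ⇓-deterministic (ev-prec0 d) (ev-prec0 d′) = ⇓-deterministic d d′
  ⇓-deterministic (ev-precS d e) (ev-precS d′ e′)
    with refl ← ⇓-deterministic d d′ = ⇓-deterministic e e′
  ⇓-deterministic (ev-mu {y = y} d below) (ev-mu {y = y′} d′ below′) with <-cmp y y′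
  ... | tri≈ _ refl _ = refl
  ... | tri< y<y′ _ _ = contradiction (⇓-deterministic d (proj₂ (below′ y y<y′))) λ ()
  ... | tri> _ _ y′<y = contradiction (⇓-deterministic d′ (proj₂ (below y′ y′<y))) λ ()

  EvalAll-deterministic : {cs : Vec (Code k) m} {xs : Vec ℕ k} {vs ws : Vec ℕ m} →
                          EvalAll cs xs vs → EvalAll cs xs ws → vs ≡ ws
  EvalAll-deterministic [] [] = refl
  EvalAll-deterministic (d ∷ e) (d′ ∷ e′) =
    cong₂ _∷_ (⇓-deterministic d d′) (EvalAll-deterministic e e′)

RecursiveVec : (Vec ℕ j → Vec ℕ k) → Set
RecursiveVec {j} {k} F = Σ (Vec (Code j) k) λ cs → ∀ xs → EvalAll cs xs (F xs)

RecursiveVec-ext : {F F′ : Vec ℕ j → Vec ℕ k} →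
                   (∀ xs → F xs ≡ F′ xs) → RecursiveVec F → RecursiveVec F′
RecursiveVec-ext F≡F′ (cs , eval) = cs , λ xs → subst (EvalAll cs xs) (F≡F′ xs) (eval xs)

[]-recursive : RecursiveVec {j} (const [])
[]-recursive = [] , λ _ → []

∷-recursive : {f : Vec ℕ j → ℕ} {F : Vec ℕ j → Vec ℕ k} →
              Recursive f → RecursiveVec F → RecursiveVec (λ xs → f xs ∷ F xs)
∷-recursive (c , eval) (cs , evals) = c ∷ cs , λ xs → eval xs ∷ evals xs

++-recursive : {F : Vec ℕ j → Vec ℕ k} {H : Vec ℕ j → Vec ℕ m} →
               RecursiveVec F → RecursiveVec H → RecursiveVec (λ xs → F xs ++ H xs)
++-recursive (cs , evals) (ds , evals′) = cs ++ ds , λ xs → append (evals xs) (evals′ xs)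
  where
  append : ∀ {a b} {cs : Vec (Code _) a} {ds : Vec (Code _) b} {xs us vs} →
           EvalAll cs xs us → EvalAll ds xs vs → EvalAll (cs ++ ds) xs (us ++ vs)
  append []      e′ = e′
  append (d ∷ e) e′ = d ∷ append e e′

tabulate-recursive : {f : Fin k → Vec ℕ j → ℕ} →
                     (∀ i → Recursive (f i)) → RecursiveVec (λ xs → tabulate λ i → f i xs)
tabulate-recursive {k = zero}  _  = []-recursive
tabulate-recursive {k = suc k} rf = ∷-recursive (rf zero) (tabulate-recursive (rf ∘ suc))

RecursiveFunctional⇒RecursiveVec : {F : Vec ℕ j → Vec ℕ k} →
                                   RecursiveFunctional F → RecursiveVec F
RecursiveFunctional⇒RecursiveVec {F = F} rF =
  RecursiveVec-ext (tabulate∘lookup ∘ F) (tabulate-recursive rF)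

∘-recursive : {f : Vec ℕ k → ℕ} {F : Vec ℕ j → Vec ℕ k} →
              Recursive f → RecursiveVec F → Recursive (f ∘ F)
∘-recursive {F = F} (c , eval) (cs , evals) =
  compᶜ c cs , λ xs → ev-comp (evals xs) (eval (F xs))

∘-recursiveVec : {H : Vec ℕ k → Vec ℕ m} {F : Vec ℕ j → Vec ℕ k} →
                 RecursiveVec H → RecursiveVec F → RecursiveVec (H ∘ F)
∘-recursiveVec {F = F} (ds , evals′) (cs , evals) =
  map (λ d → compᶜ d cs) ds , λ xs → compose (evals xs) (evals′ (F xs))
  where
  compose : ∀ {b} {ds : Vec (Code _) b} {xs ys zs} →
            EvalAll cs xs ys → EvalAll ds ys zs → EvalAll (map (λ d → compᶜ d cs) ds) xs zs
  compose e []       = []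
  compose e (d ∷ e′) = ev-comp e d ∷ compose e e′

-- The backward direction needs determinism: a derivation for P (F xs) may
-- evaluate the codes of F to some other vector, which must be F xs.
RE-∘ : {P : Vec ℕ k → Set} {F : Vec ℕ j → Vec ℕ k} →
       RE P → RecursiveVec F → RE (P ∘ F)
RE-∘ {P = P} {F} (c , P⇔dom) (cs , evals) = compᶜ c cs , λ xs → mk⇔
  (λ p → let v , d = Equivalence.to (P⇔dom (F xs)) p in v , ev-comp (evals xs) d)
  (λ { (v , ev-comp e d) → Equivalence.from (P⇔dom (F xs))
         (v , subst (λ ys → c ⊢ ys ⇓ v) (EvalAll-deterministic e (evals xs)) d) })

const-recursive : (a : ℕ) → Recursive {j} (const a)
const-recursive a = numeral a , λ xs → numeral-⇓ a xs
  where
  numeral : ℕ → Code j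
  numeral zero    = zeroᶜ
  numeral (suc a) = compᶜ succᶜ (numeral a ∷ [])

  numeral-⇓ : ∀ a (xs : Vec ℕ j) → numeral a ⊢ xs ⇓ a
  numeral-⇓ zero    xs = ev-zero
  numeral-⇓ (suc a) xs = ev-comp (numeral-⇓ a xs ∷ []) ev-succ

select : (Fin k → Fin j) → Vec ℕ j → Vec ℕ k
select ρ w = tabulate (lookup w ∘ ρ)

select-recursive : (ρ : Fin k → Fin j) → RecursiveVec (select ρ)
select-recursive ρ = tabulate-recursive λ i → projᶜ (ρ i) , λ _ → ev-proj

select-↑ˡ-++ : (xs : Vec ℕ m) (ys : Vec ℕ n) → select (_↑ˡ n) (xs ++ ys) ≡ xs
select-↑ˡ-++ xs ys = trans (tabulate-cong (lookup-++ˡ xs ys)) (tabulate∘lookup xs)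

select-↑ʳ-++ : (xs : Vec ℕ m) (ys : Vec ℕ n) → select (m ↑ʳ_) (xs ++ ys) ≡ ys
select-↑ʳ-++ xs ys = trans (tabulate-cong (lookup-++ʳ xs ys)) (tabulate∘lookup ys)

id-recursiveVec : RecursiveVec {j} id
id-recursiveVec = RecursiveVec-ext tabulate∘lookup (select-recursive id)

RE⇒index : (R : ℕ → Vec ℕ n → Set) → Acceptable n R →
           {P : Vec ℕ n → Set} → RE P → Σ ℕ λ a → ∀ x → R a x ⇔ P x
RE⇒index R (_ , iterate) {P} reP
  with t , _ , t-spec ← iterate 0 (P ∘ select (_↑ˡ 0)) (RE-∘ reP (select-recursive _)) =
  t [] , λ x → begin
    R (t []) x                   ≈⟨ t-spec [] x ⟩
    P (select (_↑ˡ 0) (x ++ [])) ≡⟨ cong P (select-↑ˡ-++ x []) ⟩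
    P x                          ∎

parameter-index : (R : ℕ → Vec ℕ n → Set) (R′ : ℕ → Vec ℕ (n + m) → Set) →
                  Acceptable n R → Acceptable (n + m) R′ → (k : Fin m) →
                  Σ (Vec ℕ m → ℕ) λ t → Recursive t ×
                    ∀ p x → R (t p) x ⇔ R′ (lookup p k) (x ++ p)
parameter-index {n = n} R R′ (_ , iterate) (universal , _) k
  with t , t-rec , t-spec ← iterate _ (λ w → R′ (lookup w (n ↑ʳ k)) w)
         (RE-∘ universal (∷-recursive (projᶜ (n ↑ʳ k) , λ _ → ev-proj) id-recursiveVec)) =
  t , t-rec , λ p x → begin
    R (t p) x                              ≈⟨ t-spec p x ⟩
    R′ (lookup (x ++ p) (n ↑ʳ k)) (x ++ p) ≡⟨ cong (λ a → R′ a (x ++ p)) (lookup-++ʳ x p k) ⟩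
    R′ (lookup p k) (x ++ p)               ∎

multiple-recursion :
  (R : (k : ℕ) → ℕ → Vec ℕ k → Set) → (∀ k → Acceptable k (R k)) →
  ∀ n {r l} (M : Fin r → Vec ℕ (n + (n + l)) → Set) → (∀ i → RE (M i)) →
  (G : Vec ℕ r → Vec ℕ l) → RecursiveVec G →
  Σ (Fin r → Vec ℕ n → ℕ) λ f → (∀ i → Recursive (f i)) ×
    (∀ i y x → R n (f i y) x ⇔ M i (x ++ y ++ G (tabulate λ j → f j y)))
multiple-recursion R acc n {r} {l} M reM G rG = f , f-rec , f-spec
  where
  N : ℕ
  N = n + (n + r)

  diagonal : (i : Fin r) → Σ (Vec ℕ (n + r) → ℕ) λ t → Recursive t ×
               ∀ p x → R n (t p) x ⇔ R N (lookup p (n ↑ʳ i)) (x ++ p)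
  diagonal i = parameter-index (R n) (R N) (acc n) (acc N) (n ↑ʳ i)

  T : Fin r → Vec ℕ (n + r) → ℕ
  T i = proj₁ (diagonal i)

  T-rec : ∀ i → Recursive (T i)
  T-rec i = proj₁ (proj₂ (diagonal i))

  Γ : Vec ℕ (n + r) → Vec ℕ l
  Γ p = G (tabulate λ j → T j p)

  K : Vec ℕ (n + r) → Vec ℕ (n + l)
  K p = select (_↑ˡ r) p ++ Γ p

  H : Vec ℕ N → Vec ℕ (n + (n + l))
  H w = select {k = n} (_↑ˡ (n + r)) w ++ K (select (n ↑ʳ_) w)

  H-rec : RecursiveVec H
  H-rec = ++-recursive (select-recursive {k = n} (_↑ˡ (n + r)))
    (∘-recursiveVec (++-recursive {k = n} (select-recursive (_↑ˡ r))
                                  (∘-recursiveVec rG (tabulate-recursive T-rec)))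
                    (select-recursive (n ↑ʳ_)))

  index : (i : Fin r) → Σ ℕ λ a → ∀ w → R N a w ⇔ M i (H w)
  index i = RE⇒index (R N) (acc N) (RE-∘ (reM i) H-rec)

  a : Fin r → ℕ
  a i = proj₁ (index i)

  f : Fin r → Vec ℕ n → ℕ
  f i y = T i (y ++ tabulate a)

  f-rec : ∀ i → Recursive (f i)
  f-rec i = ∘-recursive (T-rec i)
    (++-recursive {k = n} id-recursiveVec (tabulate-recursive (const-recursive ∘ a)))

  H-++ : ∀ y x → H (x ++ y ++ tabulate a) ≡ x ++ y ++ G (tabulate λ j → f j y)
  H-++ y x = cong₂ _++_ (select-↑ˡ-++ x p)
    (trans (cong K (select-↑ʳ-++ x p)) (cong (_++ Γ p) (select-↑ˡ-++ y (tabulate a))))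
    where p = y ++ tabulate a

  f-spec : ∀ i y x → R n (f i y) x ⇔ M i (x ++ y ++ G (tabulate λ j → f j y))
  f-spec i y x = begin
    R n (f i y) x
      ≈⟨ proj₂ (proj₂ (diagonal i)) p x ⟩
    R N (lookup p (n ↑ʳ i)) (x ++ p)
      ≡⟨ cong (λ b → R N b (x ++ p)) (trans (lookup-++ʳ y (tabulate a) i) (lookup∘tabulate a i)) ⟩
    R N (a i) (x ++ p)
      ≈⟨ proj₂ (index i) (x ++ p) ⟩
    M i (H (x ++ p))
      ≡⟨ cong (M i) (H-++ y x) ⟩
    M i (x ++ y ++ G (tabulate λ j → f j y))
      ∎
    where p = y ++ tabulate a

theorem4p3 : (R : (k : ℕ) → ℕ → Vec ℕ k → Set) → (∀ k → Acceptable k (R k)) →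
    (n : ℕ) → n ≥ 1 →
    (M₁ M₂ : Vec ℕ (n + (n + n)) → Set) → RE M₁ → RE M₂ →
    (G : Vec ℕ 2 → Vec ℕ n) → RecursiveFunctional G →
    Σ (Vec ℕ n → ℕ) λ f₁ → Σ (Vec ℕ n → ℕ) λ f₂ →
      Recursive f₁ × Recursive f₂ ×
      (∀ (y x : Vec ℕ n) →
        (R n (f₁ y) x ⇔ M₁ (x ++ y ++ G (f₁ y ∷ f₂ y ∷ []))) ×
        (R n (f₂ y) x ⇔ M₂ (x ++ y ++ G (f₁ y ∷ f₂ y ∷ []))))
theorem4p3 R acc n _ M₁ M₂ re₁ re₂ G rG =
  let f , f-rec , f-spec =
        multiple-recursion R acc n M reM G (RecursiveFunctional⇒RecursiveVec rG)
  in f zero , f (suc zero) , f-rec zero , f-rec (suc zero) ,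
     λ y x → f-spec zero y x , f-spec (suc zero) y x
  where
  M : Fin 2 → Vec ℕ (n + (n + n)) → Set
  M zero       = M₁
  M (suc zero) = M₂

  reM : ∀ i → RE (M i)
  reM zero       = re₁
  reM (suc zero) = re₂
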